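{- The following statements are equivalent: (i) every even integer can be written as the difference of two odd primes; (ii) every vertex $v\ge 2$ of $\overrightarrow{\mathcal{G}}_{\infty}$ has non-zero out-degree, i.e. $d^+_\infty(v)>0$ for all even $v\ge 2$.
   Context: Let $\mathcal{P}$ be the set of odd primes and $\mathcal{E}$ the set of non-negative even integers. $\overrightarrow{\mathcal{G}}_{\infty}$ is the directed graph with vertex set $\mathcal{E}$ and an arc $a\to b$ iff $\frac{a+b}{2}\in\mathcal{P}$ and $\frac{b-a}{2}\in\mathcal{P}$; $d^+_\infty(v)$ is the number of $w\in\mathcal{E}$ with $v\to w$. -}

module Defs where

open import Data.Nat using (ℕ; _+_; _*_; _≤_)
open import Data.Nat.Divisibility using (_∣_)
open import Data.Nat.Primality using (Prime)
open import Data.Integer as ℤ using (ℤ; +_)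
import Data.Integer.Divisibility as ℤD
open import Data.Product using (Σ; ∃; _×_)
open import Relation.Nullary using (¬_)
open import Relation.Binary.PropositionalEquality using (_≡_)

OddPrime : ℕ → Set
OddPrime p = Prime p × ¬ (2 ∣ p)

Even : ℕ → Set
Even n = 2 ∣ n

-- the arc a → b of G∞ : (a+b)/2 ∈ 𝒫 and (b-a)/2 ∈ 𝒫.
-- For even a, b these halves are p with a + b = 2p and q with b = a + 2q
-- (b - a = 2q with q ≥ 3 > 0, so no truncated subtraction is involved).
Arc : ℕ → ℕ → Set
Arc a b = (Σ ℕ λ p → OddPrime p × a + b ≡ 2 * p)
        × (Σ ℕ λ q → OddPrime q × b ≡ a + 2 * q)

OutNeighbour : ℕ → ℕ → Set
OutNeighbour v w = Even w × Arc v w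

-- d⁺∞(v) > 0 : the out-neighbourhood of v is non-empty
-- (d⁺∞(v) may be infinite, so "> 0" is rendered as "has an out-neighbour")
PositiveOutDegree : ℕ → Set
PositiveOutDegree v = ∃ λ w → OutNeighbour v w

EveryEvenIsDiffOfOddPrimes : Set
EveryEvenIsDiffOfOddPrimes =
  (n : ℤ) → (+ 2) ℤD.∣ n → Σ ℕ λ p → Σ ℕ λ q → OddPrime p × OddPrime q × n ≡ (+ p) ℤ.- (+ q)

AllOutDegreesPositive : Set
AllOutDegreesPositive = (v : ℕ) → Even v → 2 ≤ v → PositiveOutDegree v

-- A vertex v has an out-neighbour exactly when v + q and q are odd primes for some q:
-- the arc v → w has half-difference q = (w − v)/2 and half-sum (v + w)/2 = v + q, and
-- conversely w = v + 2q is an out-neighbour. So both (i) and (ii) say that every even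
-- v ≥ 2 is a gap between odd primes; negative gaps are handled by swapping p and q,
-- and the gap 0 by 3 − 3.
module Submission where

open import Defs
open import Data.Empty using (⊥-elim)
open import Data.Integer as ℤ using (ℤ; +_; -[1+_]; ∣_∣)
import Data.Integer.Properties as ℤ
import Data.Integer.Tactic.RingSolver as ℤ-Ring
open import Data.Nat using (ℕ; zero; suc; _+_; _*_; _≤_; s≤s; z≤n)
open import Data.Nat.Divisibility using (_∣?_; ∣m∣n⇒∣m+n; m∣m*n)
open import Data.Nat.Primality using (prime?)
import Data.Nat.Properties as ℕ
import Data.Nat.Tactic.RingSolver as ℕ-Ring
open import Data.Product using (Σ; _×_; _,_)
open import Function.Bundles using (_⇔_; mk⇔; Equivalence)
open import Relation.Nullary.Decidable using (from-yes; from-no)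
open import Relation.Binary.PropositionalEquality using (_≡_; refl; sym; trans; cong; subst; module ≡-Reasoning)

open Equivalence using (to; from)

OddPrimeGap : ℕ → Set
OddPrimeGap v = Σ ℕ λ q → OddPrime q × OddPrime (v + q)

DiffOfOddPrimes : ℤ → Set
DiffOfOddPrimes n = Σ ℕ λ p → Σ ℕ λ q → OddPrime p × OddPrime q × n ≡ + p ℤ.- + q

oddPrime-3 : OddPrime 3
oddPrime-3 = from-yes (prime? 3) , from-no (2 ∣? 3)

oddPrimeGap-0 : OddPrimeGap 0
oddPrimeGap-0 = 3 , oddPrime-3 , oddPrime-3

even-suc⇒2≤ : ∀ {k} → Even (suc k) → 2 ≤ suc k
even-suc⇒2≤ {zero}  2∣1 = ⊥-elim (from-no (2 ∣? 1) 2∣1)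
even-suc⇒2≤ {suc k} _   = s≤s (s≤s z≤n)

v+[v+2q]≡2[v+q] : ∀ v q → v + (v + 2 * q) ≡ 2 * (v + q)
v+[v+2q]≡2[v+q] = ℕ-Ring.solve-∀

arc⇒oddPrimeGap : ∀ {v w} → Arc v w → OddPrimeGap v
arc⇒oddPrimeGap {v} ((p , p-odd , v+w≡2p) , (q , q-odd , refl)) =
  q , q-odd , subst OddPrime p≡v+q p-odd
  where
  p≡v+q : p ≡ v + q
  p≡v+q = ℕ.*-cancelˡ-≡ p (v + q) 2 (trans (sym v+w≡2p) (v+[v+2q]≡2[v+q] v q))

oddPrimeGap⇒arc : ∀ {v q} → OddPrime q → OddPrime (v + q) → Arc v (v + 2 * q)
oddPrimeGap⇒arc {v} {q} q-odd v+q-odd =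
  (v + q , v+q-odd , v+[v+2q]≡2[v+q] v q) , (q , q-odd , refl)

positiveOutDegree⇔oddPrimeGap : ∀ {v} → Even v → PositiveOutDegree v ⇔ OddPrimeGap v
positiveOutDegree⇔oddPrimeGap {v} 2∣v = mk⇔
  (λ (_ , _ , arc) → arc⇒oddPrimeGap arc)
  (λ (q , q-odd , v+q-odd) →
    v + 2 * q , ∣m∣n⇒∣m+n 2∣v (m∣m*n q) , oddPrimeGap⇒arc q-odd v+q-odd)

+v≡+p-+q⇒p≡v+q : ∀ v p q → + v ≡ + p ℤ.- + q → p ≡ v + q
+v≡+p-+q⇒p≡v+q v p q v≡p-q = ℤ.+-injective (begin
  + p                   ≡⟨ i≡[i-j]+j (+ p) (+ q) ⟩
  (+ p ℤ.- + q) ℤ.+ + q ≡⟨ cong (ℤ._+ + q) (sym v≡p-q) ⟩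
  + v ℤ.+ + q           ≡⟨ ℤ.pos-+ v q ⟨
  + (v + q)             ∎)
  where
  open ≡-Reasoning
  i≡[i-j]+j : ∀ i j → i ≡ (i ℤ.- j) ℤ.+ j
  i≡[i-j]+j = ℤ-Ring.solve-∀

+v≡+[v+q]-+q : ∀ v q → + v ≡ + (v + q) ℤ.- + q
+v≡+[v+q]-+q v q = trans (i≡[i+j]-j (+ v) (+ q)) (cong (ℤ._- + q) (ℤ.pos-+ v q))
  where
  i≡[i+j]-j : ∀ i j → i ≡ (i ℤ.+ j) ℤ.- j
  i≡[i+j]-j = ℤ-Ring.solve-∀

diffOfOddPrimes⇔oddPrimeGap : ∀ v → DiffOfOddPrimes (+ v) ⇔ OddPrimeGap v
diffOfOddPrimes⇔oddPrimeGap v = mk⇔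
  (λ (p , q , p-odd , q-odd , v≡p-q) →
    q , q-odd , subst OddPrime (+v≡+p-+q⇒p≡v+q v p q v≡p-q) p-odd)
  (λ (q , q-odd , v+q-odd) → v + q , q , v+q-odd , q-odd , +v≡+[v+q]-+q v q)

diffOfOddPrimes-neg : ∀ {n} → DiffOfOddPrimes n → DiffOfOddPrimes (ℤ.- n)
diffOfOddPrimes-neg (p , q , p-odd , q-odd , n≡p-q) =
  q , p , q-odd , p-odd , trans (cong ℤ.-_ n≡p-q) (-[i-j]≡j-i (+ p) (+ q))
  where
  -[i-j]≡j-i : ∀ i j → ℤ.- (i ℤ.- j) ≡ j ℤ.- i
  -[i-j]≡j-i = ℤ-Ring.solve-∀

oddPrimeGap-∣∣⇒diffOfOddPrimes : ∀ n → OddPrimeGap ∣ n ∣ → DiffOfOddPrimes n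
oddPrimeGap-∣∣⇒diffOfOddPrimes (+ v)      gap = from (diffOfOddPrimes⇔oddPrimeGap v) gap
oddPrimeGap-∣∣⇒diffOfOddPrimes -[1+ m ] gap =
  diffOfOddPrimes-neg (from (diffOfOddPrimes⇔oddPrimeGap (suc m)) gap)

mainTheorem6 : EveryEvenIsDiffOfOddPrimes ⇔ AllOutDegreesPositive
mainTheorem6 = mk⇔ i⇒ii ii⇒i
  where
  i⇒ii : EveryEvenIsDiffOfOddPrimes → AllOutDegreesPositive
  i⇒ii diffs v 2∣v _ = from (positiveOutDegree⇔oddPrimeGap 2∣v)
    (to (diffOfOddPrimes⇔oddPrimeGap v) (diffs (+ v) 2∣v))

  ii⇒i : AllOutDegreesPositive → EveryEvenIsDiffOfOddPrimes
  ii⇒i positive n 2∣n = oddPrimeGap-∣∣⇒diffOfOddPrimes n (gap ∣ n ∣ 2∣n)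
    where
    gap : ∀ v → Even v → OddPrimeGap v
    gap zero    _   = oddPrimeGap-0
    gap (suc k) 2∣v = to (positiveOutDegree⇔oddPrimeGap 2∣v) (positive (suc k) 2∣v (even-suc⇒2≤ 2∣v))
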